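{- Let $G$ be a finite simple graph with minimum degree $\delta \ge 3$, girth $g \ge 5$, and a cut edge $e$. Then $4\delta - 9 \le Z(G)$.
   Context: A cut edge is an edge whose removal increases the number of connected components. The girth is the length of a shortest cycle. Zero forcing process: start with an initial set $S$ of colored vertices. A colored vertex $u$ forces an uncolored neighbor $w$ (making $w$ colored) if $w$ is the only uncolored neighbor of $u$; forces are applied repeatedly. $S$ is a zero forcing set if eventually every vertex becomes colored. $Z(G)$ is the minimum size of a zero forcing set. -}

module Defs where

open import Data.Nat using (ℕ; _≤_; _<_; suc)
open import Data.Fin using (Fin; zero; suc; toℕ; fromℕ<; _≟_)
open import Data.Fin.Subset using (Subset; _∈_; ∣_∣)
open import Data.Bool using (Bool; true; false; T)
open import Data.Vec using (tabulate)
open import Data.List using (List; []; _∷_)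
open import Data.Product using (Σ; ∃; _×_; _,_)
open import Relation.Binary.PropositionalEquality using (_≡_)
open import Relation.Nullary using (¬_)
open import Function.Definitions using (Injective)

record Graph : Set where
  field
    n      : ℕ
    adj    : Fin n → Fin n → Bool
    sym    : ∀ u v → adj u v ≡ adj v u
    irrefl : ∀ v → adj v v ≡ false

module _ (G : Graph) where
  open Graph G

  Vertex : Set
  Vertex = Fin n

  Adj : Vertex → Vertex → Set
  Adj u v = T (adj u v)

  N : Vertex → Subset n
  N v = tabulate (adj v)

  degree : Vertex → ℕ
  degree v = ∣ N v ∣

  IsMinDegree : ℕ → Set
  IsMinDegree δ = (∀ v → δ ≤ degree v) × (∃ λ v → degree v ≡ δ)

  record Cycle (k : ℕ) : Set where
    field
      3≤k     : 3 ≤ k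
      c       : Fin k → Vertex
      inj     : Injective _≡_ _≡_ c
      step    : ∀ (i : Fin k) (j : Fin k) → suc (toℕ i) ≡ toℕ j → Adj (c i) (c j)
      close   : ∀ (i : Fin k) (j : Fin k) → suc (toℕ i) ≡ k → toℕ j ≡ 0 → Adj (c i) (c j)

  GirthAtLeast : ℕ → Set
  GirthAtLeast g = ∀ k → Cycle k → g ≤ k

  data WalkAvoiding (a b : Vertex) : Vertex → Vertex → Set where
    here : ∀ {v} → WalkAvoiding a b v v
    step : ∀ {u w v} → Adj u w → ¬ (u ≡ a × w ≡ b) → ¬ (u ≡ b × w ≡ a)
         → WalkAvoiding a b w v → WalkAvoiding a b u v

  IsCutEdge : Vertex → Vertex → Set
  IsCutEdge a b = Adj a b × ¬ WalkAvoiding a b a b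

  data Colored (S : Subset n) : Vertex → Set where
    init  : ∀ {v} → v ∈ S → Colored S v
    force : ∀ {u w} → Colored S u → Adj u w
          → (∀ w′ → Adj u w′ → ¬ w′ ≡ w → Colored S w′)
          → Colored S w

  IsZeroForcingSet : Subset n → Set
  IsZeroForcingSet S = ∀ v → Colored S v

module Submission where

-- One endpoint x of the bridge (y being the other) can be coloured without any
-- force along xy, so the colouring can be run without the force y → x. Let X, Y
-- be the components of x, y in G − xy. For a side X and a set T ⊇ S ∩ X, the
-- sources u ≠ v of the first two forces into X ∖ T lie in X, and N[u] ∩ X,
-- N[v] ∩ X are covered by T plus the two forced vertices. Each has ≥ δ elements
-- (only the bridge leaves X) and by girth ≥ 5 they share at most two vertices,
-- so 2δ ≤ ∣T∣ + 4 (sideBound). Taking T = S ∩ X and T = (S ∩ Y) ∪ {y} and adding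
-- gives 4δ ≤ ∣S∣ + 9 (twoSides).

open import Defs
open import Data.Nat using (ℕ; zero; suc; _+_; _*_; _∸_; _≤_; _≤?_; z≤n; s≤s; s≤s⁻¹)
open import Data.Nat.Properties
  using (+-comm; +-assoc; +-suc; +-identityʳ; m≤m+n; ≤-trans; ≤-reflexive; +-mono-≤; +-monoˡ-≤; +-monoʳ-≤;
         suc-injective; m≤n+o⇒m∸n≤o; module ≤-Reasoning)
open import Data.Nat.Tactic.RingSolver using (solve-∀)
open import Data.Bool using (Bool; true; false; T)
open import Data.Bool.Properties using (T-≡)
open import Data.Fin using (Fin; zero; suc; toℕ; fromℕ; _≟_)
open import Data.Fin.Properties using (¬∀⟶∃¬; any?; toℕ-injective; toℕ-fromℕ)
open import Data.Fin.Subset using (Subset; _∈_; _∉_; _⊆_; _⊈_; _∪_; _∩_; ⁅_⁆; ∣_∣) renaming (⊥ to ∅)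
open import Data.Fin.Subset.Properties
  using (_∈?_; _⊆?_; p⊆q⇒∣p∣≤∣q∣; ∣⊥∣≡0; ∣⁅x⁆∣≡1; x∈⁅x⁆; x∈⁅y⁆⇒x≡y; x∉⁅y⁆⇒x≢y; x∈p∪q⁺; x∈p∪q⁻; x∈p∩q⁺; x∈p∩q⁻;
         p⊆p∪q; q⊆p∪q; p∩q⊆p; p∩q⊆q; ∪-assoc; ⊆-trans)
open import Data.Vec using (Vec; []; _∷_; lookup; tabulate)
open import Data.Vec.Properties using (lookup∘tabulate; []=⇒lookup; lookup⇒[]=)
open import Data.Vec.Relation.Unary.All using ([]; _∷_)
open import Data.Vec.Relation.Unary.AllPairs using ([]; _∷_)
open import Data.Vec.Relation.Unary.Linked using (Linked; [-]; _∷_)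
open import Data.Vec.Relation.Unary.Unique.Propositional using (Unique)
open import Data.Vec.Relation.Unary.Unique.Propositional.Properties using (lookup-injective)
open import Data.Product using (∃; _×_; _,_; proj₁; proj₂)
open import Data.Sum as Sum using (_⊎_; inj₁; inj₂)
open import Data.Empty using (⊥; ⊥-elim)
open import Effect.Monad using (RawMonad)
open import Function using (_∘_; id; case_of_; Equivalence)
open import Level using (0ℓ)
open import Relation.Nullary using (¬_; Dec; yes; no; ¬¬-map)
open import Relation.Nullary.Decidable
  using (T?; isYes; toWitness; fromWitness; decidable-stable; ¬¬-excluded-middle; _×-dec_; _⊎-dec_; _→-dec_)
open import Relation.Nullary.Negation using (¬¬-Monad)
open import Relation.Binary.PropositionalEquality
  using (_≡_; _≢_; refl; cong; cong₂; trans; sym; subst; module ≡-Reasoning)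

∣p∪q∣+∣p∩q∣≡∣p∣+∣q∣ : ∀ {n} (p q : Subset n) → ∣ p ∪ q ∣ + ∣ p ∩ q ∣ ≡ ∣ p ∣ + ∣ q ∣
∣p∪q∣+∣p∩q∣≡∣p∣+∣q∣ []          []          = refl
∣p∪q∣+∣p∩q∣≡∣p∣+∣q∣ (true ∷ p)  (true ∷ q)  = cong suc (begin
  ∣ p ∪ q ∣ + suc ∣ p ∩ q ∣    ≡⟨ +-suc ∣ p ∪ q ∣ ∣ p ∩ q ∣ ⟩
  suc (∣ p ∪ q ∣ + ∣ p ∩ q ∣)  ≡⟨ cong suc (∣p∪q∣+∣p∩q∣≡∣p∣+∣q∣ p q) ⟩
  suc (∣ p ∣ + ∣ q ∣)          ≡⟨ +-suc ∣ p ∣ ∣ q ∣ ⟨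
  ∣ p ∣ + suc ∣ q ∣            ∎)
  where open ≡-Reasoning
∣p∪q∣+∣p∩q∣≡∣p∣+∣q∣ (true ∷ p)  (false ∷ q) = cong suc (∣p∪q∣+∣p∩q∣≡∣p∣+∣q∣ p q)
∣p∪q∣+∣p∩q∣≡∣p∣+∣q∣ (false ∷ p) (true ∷ q)  =
  trans (cong suc (∣p∪q∣+∣p∩q∣≡∣p∣+∣q∣ p q)) (sym (+-suc ∣ p ∣ ∣ q ∣))
∣p∪q∣+∣p∩q∣≡∣p∣+∣q∣ (false ∷ p) (false ∷ q) = ∣p∪q∣+∣p∩q∣≡∣p∣+∣q∣ p q

∣p∪q∣≤∣p∣+∣q∣ : ∀ {n} (p q : Subset n) → ∣ p ∪ q ∣ ≤ ∣ p ∣ + ∣ q ∣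
∣p∪q∣≤∣p∣+∣q∣ p q = ≤-trans (m≤m+n ∣ p ∪ q ∣ ∣ p ∩ q ∣) (≤-reflexive (∣p∪q∣+∣p∩q∣≡∣p∣+∣q∣ p q))

∣⁅x⁆∪⁅y⁆∣≤2 : ∀ {n} (x y : Fin n) → ∣ ⁅ x ⁆ ∪ ⁅ y ⁆ ∣ ≤ 2
∣⁅x⁆∪⁅y⁆∣≤2 x y = ≤-trans (∣p∪q∣≤∣p∣+∣q∣ ⁅ x ⁆ ⁅ y ⁆) (≤-reflexive (cong₂ _+_ (∣⁅x⁆∣≡1 x) (∣⁅x⁆∣≡1 y)))

∪-least : ∀ {n} {p q r : Subset n} → p ⊆ r → q ⊆ r → p ∪ q ⊆ r
∪-least {p = p} {q} p⊆r q⊆r i∈p∪q with x∈p∪q⁻ p q i∈p∪q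
... | inj₁ i∈p = p⊆r i∈p
... | inj₂ i∈q = q⊆r i∈q

disjoint-∣p∣+∣q∣≤∣r∣ : ∀ {n} {p q r : Subset n} → (∀ {i} → i ∈ p → i ∈ q → ⊥)
  → p ⊆ r → q ⊆ r → ∣ p ∣ + ∣ q ∣ ≤ ∣ r ∣
disjoint-∣p∣+∣q∣≤∣r∣ {n} {p} {q} {r} disjoint p⊆r q⊆r = begin
  ∣ p ∣ + ∣ q ∣          ≡⟨ ∣p∪q∣+∣p∩q∣≡∣p∣+∣q∣ p q ⟨
  ∣ p ∪ q ∣ + ∣ p ∩ q ∣  ≤⟨ +-mono-≤ (p⊆q⇒∣p∣≤∣q∣ (∪-least p⊆r q⊆r)) (p⊆q⇒∣p∣≤∣q∣ p∩q⊆∅) ⟩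
  ∣ r ∣ + ∣ ∅ {n} ∣      ≡⟨ cong (∣ r ∣ +_) (∣⊥∣≡0 n) ⟩
  ∣ r ∣ + 0              ≡⟨ +-identityʳ ∣ r ∣ ⟩
  ∣ r ∣                  ∎
  where
  open ≤-Reasoning
  p∩q⊆∅ : p ∩ q ⊆ ∅
  p∩q⊆∅ i∈p∩q = ⊥-elim (disjoint (proj₁ (x∈p∩q⁻ p q i∈p∩q)) (proj₂ (x∈p∩q⁻ p q i∈p∩q)))

⊈⇒witness : ∀ {n} {p q : Subset n} → p ⊈ q → ∃ λ i → i ∈ p × i ∉ q
⊈⇒witness {n} {p} {q} p⊈q
  with ¬∀⟶∃¬ n (λ i → i ∈ p → i ∈ q) (λ i → i ∈? p →-dec i ∈? q) (λ all → p⊈q (all _))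
... | i , ¬[i∈p⇒i∈q] with i ∈? p
...   | yes i∈p = i , i∈p , λ i∈q → ¬[i∈p⇒i∈q] (λ _ → i∈q)
...   | no  i∉p = ⊥-elim (¬[i∈p⇒i∈q] (λ i∈p → ⊥-elim (i∉p i∈p)))

¬¬-decideAll : ∀ {n} (P : Fin n → Set) → ¬ ¬ (∀ i → Dec (P i))
¬¬-decideAll {zero}  P giveUp = giveUp (λ ())
¬¬-decideAll {suc n} P giveUp = ¬¬-excluded-middle λ P₀? → ¬¬-decideAll (P ∘ suc) λ Pₛ? →
  giveUp λ { zero → P₀? ; (suc i) → Pₛ? i }

∈tabulate⁻ : ∀ {n} {f : Fin n → Bool} {i} → i ∈ tabulate f → T (f i)
∈tabulate⁻ {f = f} {i} i∈ = Equivalence.from T-≡ (trans (sym (lookup∘tabulate f i)) ([]=⇒lookup i∈))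

∈tabulate⁺ : ∀ {n} {f : Fin n → Bool} {i} → T (f i) → i ∈ tabulate f
∈tabulate⁺ {f = f} {i} t = lookup⇒[]= i _ (trans (lookup∘tabulate f i) (Equivalence.to T-≡ t))

⟦_⟧ : ∀ {n} {P : Fin n → Set} → (∀ i → Dec (P i)) → Subset n
⟦ P? ⟧ = tabulate (λ i → isYes (P? i))

∈⟦⟧⁻ : ∀ {n} {P : Fin n → Set} {P? : ∀ i → Dec (P i)} {i} → i ∈ ⟦ P? ⟧ → P i
∈⟦⟧⁻ i∈ = toWitness (∈tabulate⁻ i∈)

∈⟦⟧⁺ : ∀ {n} {P : Fin n → Set} {P? : ∀ i → Dec (P i)} {i} → P i → i ∈ ⟦ P? ⟧
∈⟦⟧⁺ p = ∈tabulate⁺ (fromWitness p)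

module GraphBasics (G : Graph) where
  open Graph G using (n; adj)

  adj-sym : ∀ {u w} → Adj G u w → Adj G w u
  adj-sym {u} {w} = subst T (Graph.sym G u w)

  adj-irrefl : ∀ {u w} → Adj G u w → u ≢ w
  adj-irrefl {u} uu refl = subst T (Graph.irrefl G u) uu

  adj? : ∀ u w → Dec (Adj G u w)
  adj? u w = T? (adj u w)

  N[_] : Vertex G → Subset n
  N[ u ] = ⁅ u ⁆ ∪ N G u

  adj∈N[] : ∀ {u i} → Adj G u i → i ∈ N[ u ]
  adj∈N[] ui = x∈p∪q⁺ (inj₂ (∈tabulate⁺ ui))

  ∈N[]⁻ : ∀ {u i} → i ∈ N[ u ] → i ≡ u ⊎ Adj G u i
  ∈N[]⁻ {u} i∈ with x∈p∪q⁻ ⁅ u ⁆ (N G u) i∈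
  ... | inj₁ i∈⁅u⁆ = inj₁ (x∈⁅y⁆⇒x≡y u i∈⁅u⁆)
  ... | inj₂ i∈N   = inj₂ (∈tabulate⁻ i∈N)

  -- u ∉ N(u), so the closed neighbourhood has degree + 1 elements.
  1+degree≤∣N[]∣ : ∀ u → suc (degree G u) ≤ ∣ N[ u ] ∣
  1+degree≤∣N[]∣ u = subst (_≤ ∣ N[ u ] ∣) (cong (_+ degree G u) (∣⁅x⁆∣≡1 u))
    (disjoint-∣p∣+∣q∣≤∣r∣ (λ i∈⁅u⁆ i∈N → adj-irrefl (∈tabulate⁻ i∈N) (sym (x∈⁅y⁆⇒x≡y u i∈⁅u⁆)))
      (p⊆p∪q (N G u)) (q⊆p∪q ⁅ u ⁆ (N G u)))

  linked-step : ∀ {k} {vs : Vec (Vertex G) k} → Linked (Adj G) vs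
    → ∀ i j → suc (toℕ i) ≡ toℕ j → Adj G (lookup vs i) (lookup vs j)
  linked-step {vs = _ ∷ _ ∷ _} (uv ∷ _)  zero    (suc zero)    _  = uv
  linked-step                  (_ ∷ path) (suc i) (suc j)       eq = linked-step path i j (suc-injective eq)
  linked-step                  (_ ∷ _)    zero    zero          ()
  linked-step                  (_ ∷ _)    zero    (suc (suc _)) ()
  linked-step                  (_ ∷ _)    (suc _) zero          ()
  linked-step                  [-]        zero    zero          ()

  cycleFrom : ∀ {m} (vs : Vec (Vertex G) (suc m)) → 2 ≤ m → Unique vs → Linked (Adj G) vs
    → Adj G (lookup vs (fromℕ m)) (lookup vs zero) → Cycle G (suc m)
  cycleFrom {m} vs 2≤m distinct path closing = record
    { 3≤k   = s≤s 2≤m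
    ; c     = lookup vs
    ; inj   = λ {i} {j} → lookup-injective distinct i j
    ; step  = linked-step path
    ; close = close
    }
    where
    close : ∀ i j → suc (toℕ i) ≡ suc m → toℕ j ≡ 0 → Adj G (lookup vs i) (lookup vs j)
    close i j i-last j-first
      rewrite toℕ-injective {i = i} (trans (suc-injective i-last) (sym (toℕ-fromℕ m)))
            | toℕ-injective {i = j} {j = zero} j-first = closing

module Girth (G : Graph) (girth : GirthAtLeast G 5) where
  open GraphBasics G

  noTriangle : ∀ {u v w} → Adj G u v → Adj G v w → Adj G w u → ⊥
  noTriangle {u} {v} {w} uv vw wu with girth 3 (cycleFrom (u ∷ v ∷ w ∷ []) (s≤s (s≤s z≤n))
    ((adj-irrefl uv ∷ adj-irrefl (adj-sym wu) ∷ []) ∷ (adj-irrefl vw ∷ []) ∷ [] ∷ [])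
    (uv ∷ vw ∷ [-]) wu)
  ... | s≤s (s≤s (s≤s ()))

  noSquare : ∀ {v₀ v₁ v₂ v₃} → Adj G v₀ v₁ → Adj G v₁ v₂ → Adj G v₂ v₃ → Adj G v₃ v₀
    → v₀ ≢ v₂ → v₁ ≢ v₃ → ⊥
  noSquare {v₀} {v₁} {v₂} {v₃} e₀ e₁ e₂ e₃ v₀≢v₂ v₁≢v₃
    with girth 4 (cycleFrom (v₀ ∷ v₁ ∷ v₂ ∷ v₃ ∷ []) (s≤s (s≤s z≤n))
      ((adj-irrefl e₀ ∷ v₀≢v₂ ∷ adj-irrefl (adj-sym e₃) ∷ [])
        ∷ (adj-irrefl e₁ ∷ v₁≢v₃ ∷ []) ∷ (adj-irrefl e₂ ∷ []) ∷ [] ∷ [])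
      (e₀ ∷ e₁ ∷ e₂ ∷ [-]) e₃)
  ... | s≤s (s≤s (s≤s (s≤s ())))

  commonNeighbour : ∀ {u v i} → u ≢ v → ¬ Adj G u v → i ∈ N[ u ] → i ∈ N[ v ]
    → Adj G u i × Adj G v i
  commonNeighbour u≢v ¬uv i∈N[u] i∈N[v] with ∈N[]⁻ i∈N[u] | ∈N[]⁻ i∈N[v]
  ... | inj₂ ui   | inj₂ vi   = ui , vi
  ... | inj₁ refl | inj₁ refl = ⊥-elim (u≢v refl)
  ... | inj₁ refl | inj₂ vu   = ⊥-elim (¬uv (adj-sym vu))
  ... | inj₂ uv   | inj₁ refl = ⊥-elim (¬uv uv)

  -- Two distinct closed neighbourhoods meet in at most two vertices: the two
  -- centres if they are adjacent (no triangle), otherwise one common neighbour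
  -- (no 4-cycle).
  N[u]∩N[v]⊆pair : ∀ {u v} → u ≢ v → ∃ λ c₁ → ∃ λ c₂ → N[ u ] ∩ N[ v ] ⊆ ⁅ c₁ ⁆ ∪ ⁅ c₂ ⁆
  N[u]∩N[v]⊆pair {u} {v} u≢v with adj? u v
  ... | yes uv = u , v , centres
    where
    centres : N[ u ] ∩ N[ v ] ⊆ ⁅ u ⁆ ∪ ⁅ v ⁆
    centres i∈ with x∈p∩q⁻ N[ u ] N[ v ] i∈
    ... | i∈N[u] , i∈N[v] with ∈N[]⁻ i∈N[u] | ∈N[]⁻ i∈N[v]
    ...   | inj₁ refl | _         = x∈p∪q⁺ (inj₁ (x∈⁅x⁆ u))
    ...   | inj₂ _    | inj₁ refl = x∈p∪q⁺ (inj₂ (x∈⁅x⁆ v))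
    ...   | inj₂ ui   | inj₂ vi   = ⊥-elim (noTriangle uv vi (adj-sym ui))
  ... | no ¬uv with any? (λ z → adj? u z ×-dec adj? v z)
  ...   | yes (z , uz , vz) = z , z , p⊆p∪q ⁅ z ⁆ ∘ onlyZ
    where
    onlyZ : N[ u ] ∩ N[ v ] ⊆ ⁅ z ⁆
    onlyZ {i} i∈ with x∈p∩q⁻ N[ u ] N[ v ] i∈
    ... | i∈N[u] , i∈N[v] with commonNeighbour u≢v ¬uv i∈N[u] i∈N[v] | i ≟ z
    ...   | _       | yes refl = x∈⁅x⁆ z
    ...   | ui , vi | no i≢z   = ⊥-elim (noSquare uz (adj-sym vz) vi (adj-sym ui) u≢v (i≢z ∘ sym))
  ...   | no ¬common = u , u , λ i∈ → ⊥-elim (¬common (_ , uncurried (x∈p∩q⁻ N[ u ] N[ v ] i∈)))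
    where
    uncurried : ∀ {i} → i ∈ N[ u ] × i ∈ N[ v ] → Adj G u i × Adj G v i
    uncurried (i∈N[u] , i∈N[v]) = commonNeighbour u≢v ¬uv i∈N[u] i∈N[v]

  ∣N[u]∩N[v]∣≤2 : ∀ {u v} → u ≢ v → ∣ N[ u ] ∩ N[ v ] ∣ ≤ 2
  ∣N[u]∩N[v]∣≤2 u≢v =
    let c₁ , c₂ , ⊆pair = N[u]∩N[v]⊆pair u≢v
    in ≤-trans (p⊆q⇒∣p∣≤∣q∣ ⊆pair) (∣⁅x⁆∪⁅y⁆∣≤2 c₁ c₂)

module Forcing (G : Graph) (S : Subset (Graph.n G)) where
  open Graph G using (n)
  open GraphBasics G

  data Col (F : Vertex G → Vertex G → Set) : Vertex G → Set where
    init  : ∀ {v} → v ∈ S → Col F v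
    force : ∀ {u w} → Col F u → Adj G u w → ¬ F u w
          → (∀ w′ → Adj G u w′ → w′ ≢ w → Col F w′) → Col F w

  weaken : ∀ {F F′ : Vertex G → Vertex G → Set} → (∀ {u w} → F′ u w → F u w)
    → ∀ {v} → Col F v → Col F′ v
  weaken F′⊆F (init v∈S) = init v∈S
  weaken F′⊆F (force cu uw allowed others) =
    force (weaken F′⊆F cu) uw (allowed ∘ F′⊆F) (λ w′ uw′ w′≢w → weaken F′⊆F (others w′ uw′ w′≢w))

  avoidForces : ∀ {F : Vertex G → Vertex G → Set} → (∀ u w → Dec (F u w))
    → (∀ {u w} → F u w → Col F u → Col F w)
    → ∀ {v} → Colored G S v → Col F v
  avoidForces F? bypass (init v∈S) = init v∈S
  avoidForces F? bypass (force {u} {w} cu uw others) with F? u w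
  ... | yes forbidden = bypass forbidden (avoidForces F? bypass cu)
  ... | no  allowed   = force (avoidForces F? bypass cu) uw allowed
                          (λ w′ uw′ w′≢w → avoidForces F? bypass (others w′ uw′ w′≢w))

  record FirstForce (F : Vertex G → Vertex G → Set) (X T : Subset n) : Set where
    constructor forceInto
    field
      source target : Vertex G
      edge          : Adj G source target
      permitted     : ¬ F source target
      target∈X      : target ∈ X
      target∉T      : target ∉ T
      saturated     : N[ source ] ∩ X ⊆ T ∪ ⁅ target ⁆

  -- If T contains the initial colours inside X and some vertex of X ∖ T gets
  -- coloured, then the first force into X ∖ T is a FirstForce: otherwise the
  -- force's source had an earlier-coloured neighbour in X ∖ T.
  firstForce : ∀ {F} {X T : Subset n} → S ∩ X ⊆ T
    → ∀ {v} → Col F v → v ∈ X → v ∉ T → FirstForce F X T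
  firstForce S∩X⊆T (init v∈S) v∈X v∉T = ⊥-elim (v∉T (S∩X⊆T (x∈p∩q⁺ (v∈S , v∈X))))
  firstForce {X = X} {T} S∩X⊆T (force {u} {w} cu uw allowed others) w∈X w∉T
    with N[ u ] ∩ X ⊆? T ∪ ⁅ w ⁆
  ... | yes saturated = forceInto u w uw allowed w∈X w∉T saturated
  ... | no unsaturated with ⊈⇒witness unsaturated
  ...   | i , i∈N[u]∩X , i∉T∪⁅w⁆ with x∈p∩q⁻ N[ u ] X i∈N[u]∩X
  ...     | i∈N[u] , i∈X with ∈N[]⁻ i∈N[u]
  ...       | inj₁ refl = firstForce S∩X⊆T cu i∈X (i∉T∪⁅w⁆ ∘ x∈p∪q⁺ ∘ inj₁)
  ...       | inj₂ ui   = firstForce S∩X⊆T (others i ui i≢w) i∈X (i∉T∪⁅w⁆ ∘ x∈p∪q⁺ ∘ inj₁)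
    where
    i≢w : i ≢ w
    i≢w refl = i∉T∪⁅w⁆ (x∈p∪q⁺ (inj₂ (x∈⁅x⁆ w)))

module Walks (G : Graph) where
  open GraphBasics G

  snoc : ∀ {a b u v w} → WalkAvoiding G a b u v → Adj G v w
    → ¬ (v ≡ a × w ≡ b) → ¬ (v ≡ b × w ≡ a) → WalkAvoiding G a b u w
  snoc here                   vw ≢ab ≢ba = step vw ≢ab ≢ba here
  snoc (step uu′ ≢ab′ ≢ba′ p) vw ≢ab ≢ba = step uu′ ≢ab′ ≢ba′ (snoc p vw ≢ab ≢ba)

  reverse : ∀ {a b u v} → WalkAvoiding G a b u v → WalkAvoiding G a b v u
  reverse here                = here
  reverse (step uw ≢ab ≢ba p) =
    snoc (reverse p) (adj-sym uw) (λ (w≡a , u≡b) → ≢ba (u≡b , w≡a)) (λ (w≡b , u≡a) → ≢ab (u≡a , w≡b))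

  _++_ : ∀ {a b u v w} → WalkAvoiding G a b u v → WalkAvoiding G a b v w → WalkAvoiding G a b u w
  here                ++ q = q
  step uw ≢ab ≢ba p   ++ q = step uw ≢ab ≢ba (p ++ q)

  swapEdge : ∀ {a b u v} → WalkAvoiding G a b u v → WalkAvoiding G b a u v
  swapEdge here                = here
  swapEdge (step uw ≢ab ≢ba p) = step uw ≢ba ≢ab (swapEdge p)

  cut-sym : ∀ {a b} → ¬ WalkAvoiding G a b a b → ¬ WalkAvoiding G b a b a
  cut-sym cut p = cut (reverse (swapEdge p))

module Component (G : Graph) {x y : Vertex G} (cut : ¬ WalkAvoiding G x y x y) where
  open GraphBasics G
  open Walks G

  Reach : Vertex G → Set
  Reach = WalkAvoiding G x y x

  extend : ∀ {u w} → Reach u → Adj G u w → ¬ (u ≡ x × w ≡ y) → Reach w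
  extend p uw ≢xy = snoc p uw ≢xy (λ (u≡y , _) → cut (subst Reach u≡y p))

  exitOnly : ∀ {u i} → Reach u → Adj G u i → ¬ Reach i → i ≡ y
  exitOnly p ui unreached = decidable-stable (_ ≟ y) (λ i≢y → unreached (extend p ui (i≢y ∘ proj₂)))

  entryOnly : ∀ {u w} → Reach w → Adj G u w → ¬ (u ≡ y × w ≡ x) → Reach u
  entryOnly p uw ≢yx = extend p (adj-sym uw) (λ (w≡x , u≡y) → ≢yx (u≡y , w≡x))

  separated : ∀ {i} → Reach i → WalkAvoiding G y x y i → ⊥
  separated p q = cut (p ++ reverse (swapEdge q))

module Side (G : Graph) (girth : GirthAtLeast G 5) (S : Subset (Graph.n G))
  {δ : ℕ} (minDegree : ∀ v → δ ≤ degree G v)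
  (X : Subset (Graph.n G)) (exit : Vertex G) (closed : ∀ {u i} → u ∈ X → Adj G u i → i ∉ X → i ≡ exit)
  where
  open Graph G using (n)
  open GraphBasics G
  open Girth G girth
  open Forcing G S

  -- A vertex of X has at most one neighbour (the exit) outside X.
  sideDegree : ∀ {u} → u ∈ X → δ ≤ ∣ N[ u ] ∩ X ∣
  sideDegree {u} u∈X = s≤s⁻¹ (begin
    suc δ                          ≤⟨ s≤s (minDegree u) ⟩
    suc (degree G u)               ≤⟨ 1+degree≤∣N[]∣ u ⟩
    ∣ N[ u ] ∣                     ≤⟨ p⊆q⇒∣p∣≤∣q∣ covered ⟩
    ∣ ⁅ exit ⁆ ∪ (N[ u ] ∩ X) ∣    ≤⟨ ∣p∪q∣≤∣p∣+∣q∣ ⁅ exit ⁆ _ ⟩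
    ∣ ⁅ exit ⁆ ∣ + ∣ N[ u ] ∩ X ∣  ≡⟨ cong (_+ ∣ N[ u ] ∩ X ∣) (∣⁅x⁆∣≡1 exit) ⟩
    suc ∣ N[ u ] ∩ X ∣             ∎)
    where
    open ≤-Reasoning
    covered : N[ u ] ⊆ ⁅ exit ⁆ ∪ (N[ u ] ∩ X)
    covered {i} i∈N[u] with i ∈? X
    ... | yes i∈X = x∈p∪q⁺ (inj₂ (x∈p∩q⁺ (i∈N[u] , i∈X)))
    ... | no  i∉X with ∈N[]⁻ i∈N[u]
    ...   | inj₁ refl = ⊥-elim (i∉X u∈X)
    ...   | inj₂ ui   = x∈p∪q⁺ (inj₁ (subst (_∈ ⁅ exit ⁆) (sym (closed u∈X ui i∉X)) (x∈⁅x⁆ exit)))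

  -- The counting heart of the proof: if U covers the neighbourhoods inside X of
  -- two distinct vertices of X, then U is large, since these neighbourhoods have
  -- at least δ elements each and overlap in at most two.
  twoNeighbourhoods : ∀ {u v U} → u ≢ v → u ∈ X → v ∈ X
    → N[ u ] ∩ X ⊆ U → N[ v ] ∩ X ⊆ U → δ + δ ≤ ∣ U ∣ + 2
  twoNeighbourhoods {u} {v} {U} u≢v u∈X v∈X A⊆U B⊆U = begin
    δ + δ                            ≤⟨ +-mono-≤ (sideDegree u∈X) (sideDegree v∈X) ⟩
    ∣ N[ u ] ∩ X ∣ + ∣ N[ v ] ∩ X ∣  ≡⟨ ∣p∪q∣+∣p∩q∣≡∣p∣+∣q∣ (N[ u ] ∩ X) (N[ v ] ∩ X) ⟨
    ∣ (N[ u ] ∩ X) ∪ (N[ v ] ∩ X) ∣ + ∣ (N[ u ] ∩ X) ∩ (N[ v ] ∩ X) ∣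
      ≤⟨ +-mono-≤ (p⊆q⇒∣p∣≤∣q∣ (∪-least A⊆U B⊆U)) shared≤2 ⟩
    ∣ U ∣ + 2                        ∎
    where
    open ≤-Reasoning
    inN[u]∩N[v] : (N[ u ] ∩ X) ∩ (N[ v ] ∩ X) ⊆ N[ u ] ∩ N[ v ]
    inN[u]∩N[v] i∈ with x∈p∩q⁻ (N[ u ] ∩ X) (N[ v ] ∩ X) i∈
    ... | i∈A , i∈B = x∈p∩q⁺ (proj₁ (x∈p∩q⁻ N[ u ] X i∈A) , proj₁ (x∈p∩q⁻ N[ v ] X i∈B))
    shared≤2 : ∣ (N[ u ] ∩ X) ∩ (N[ v ] ∩ X) ∣ ≤ 2
    shared≤2 = ≤-trans (p⊆q⇒∣p∣≤∣q∣ inN[u]∩N[v]) (∣N[u]∩N[v]∣≤2 u≢v)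

  exceptionalBound : ∀ {u v} (T E : Subset n) → ∣ E ∣ ≤ 2 → u ≢ v → u ∈ X → v ∈ X
    → N[ u ] ∩ X ⊆ T ∪ E → N[ v ] ∩ X ⊆ T ∪ E → δ + δ ≤ ∣ T ∣ + 4
  exceptionalBound T E ∣E∣≤2 u≢v u∈X v∈X A⊆ B⊆ = begin
    δ + δ              ≤⟨ twoNeighbourhoods u≢v u∈X v∈X A⊆ B⊆ ⟩
    ∣ T ∪ E ∣ + 2      ≤⟨ +-monoˡ-≤ 2 (∣p∪q∣≤∣p∣+∣q∣ T E) ⟩
    ∣ T ∣ + ∣ E ∣ + 2  ≤⟨ +-monoˡ-≤ 2 (+-monoʳ-≤ ∣ T ∣ ∣E∣≤2) ⟩
    ∣ T ∣ + 2 + 2      ≡⟨ +-assoc ∣ T ∣ 2 2 ⟩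
    ∣ T ∣ + 4          ∎
    where open ≤-Reasoning

  inside : ∀ {u U} → X ⊆ U → N[ u ] ∩ X ⊆ U
  inside {u} X⊆U = X⊆U ∘ p∩q⊆q N[ u ] X

  anotherVertex : 2 ≤ δ → ∀ {u} → u ∈ X → ∃ λ z → z ∈ X × z ≢ u
  anotherVertex 2≤δ {u} u∈X with N[ u ] ∩ X ⊆? ⁅ u ⁆
  ... | no ⊈⁅u⁆ =
    let z , z∈N[u]∩X , z∉⁅u⁆ = ⊈⇒witness ⊈⁅u⁆
    in z , proj₂ (x∈p∩q⁻ N[ u ] X z∈N[u]∩X) , x∉⁅y⁆⇒x≢y z∉⁅u⁆
  ... | yes ⊆⁅u⁆ = ⊥-elim (2≰1 (begin
    2                ≤⟨ 2≤δ ⟩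
    δ                ≤⟨ sideDegree u∈X ⟩
    ∣ N[ u ] ∩ X ∣   ≤⟨ p⊆q⇒∣p∣≤∣q∣ ⊆⁅u⁆ ⟩
    ∣ ⁅ u ⁆ ∣        ≡⟨ ∣⁅x⁆∣≡1 u ⟩
    1                ∎))
    where
    open ≤-Reasoning
    2≰1 : ¬ 2 ≤ 1
    2≰1 (s≤s ())

  module _ {F : Vertex G → Vertex G → Set} (T : Subset n) (S∩X⊆T : S ∩ X ⊆ T)
    (inward : ∀ {u w} → Adj G u w → ¬ F u w → w ∈ X → w ∉ T → u ∈ X)
    (coloured : ∀ v → Col F v)
    where

    -- After the first force u → w into X ∖ T: if X ⊆ T ∪ {w}, compare u with w;
    -- otherwise compare u with the source v of the first force into
    -- X ∖ (T ∪ {w}), say v → x′, with exceptional set {w, x′}.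
    afterFirst : FirstForce F X T → δ + δ ≤ ∣ T ∣ + 4
    afterFirst (forceInto u w uw allowed w∈X w∉T saturated) = cases (X ⊆? T ∪ ⁅ w ⁆)
      where
      u∈X : u ∈ X
      u∈X = inward uw allowed w∈X w∉T

      afterSecond : FirstForce F X (T ∪ ⁅ w ⁆) → δ + δ ≤ ∣ T ∣ + 4
      afterSecond (forceInto v x′ vx′ allowed′ x′∈X x′∉T∪w saturated′) =
        exceptionalBound T (⁅ w ⁆ ∪ ⁅ x′ ⁆) (∣⁅x⁆∪⁅y⁆∣≤2 w x′) u≢v u∈X v∈X
          (⊆-trans saturated (subst (T ∪ ⁅ w ⁆ ⊆_) (∪-assoc T ⁅ w ⁆ ⁅ x′ ⁆) (p⊆p∪q ⁅ x′ ⁆)))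
          (subst (N[ v ] ∩ X ⊆_) (∪-assoc T ⁅ w ⁆ ⁅ x′ ⁆) saturated′)
        where
        v∈X : v ∈ X
        v∈X = inward vx′ allowed′ x′∈X (x′∉T∪w ∘ p⊆p∪q ⁅ w ⁆)
        -- x′ ∈ N[ v ] ∩ X lies outside T ∪ {w}, unlike N[ u ] ∩ X.
        u≢v : u ≢ v
        u≢v refl = x′∉T∪w (saturated (x∈p∩q⁺ (adj∈N[] vx′ , x′∈X)))

      cases : Dec (X ⊆ T ∪ ⁅ w ⁆) → δ + δ ≤ ∣ T ∣ + 4
      cases (yes X⊆T∪w) = exceptionalBound T ⁅ w ⁆ (≤-trans (≤-reflexive (∣⁅x⁆∣≡1 w)) (s≤s z≤n))
        (adj-irrefl uw) u∈X w∈X saturated (inside X⊆T∪w)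
      cases (no X⊈T∪w) =
        let v₀ , v₀∈X , v₀∉T∪w = ⊈⇒witness X⊈T∪w
        in afterSecond (firstForce (p⊆p∪q ⁅ w ⁆ ∘ S∩X⊆T) (coloured v₀) v₀∈X v₀∉T∪w)

    -- If X ⊆ T any two vertices of X will do; otherwise use the first force into X ∖ T.
    sideBound : 2 ≤ δ → ∀ {x} → x ∈ X → δ + δ ≤ ∣ T ∣ + 4
    sideBound 2≤δ x∈X with X ⊆? T
    ... | yes X⊆T =
      let z , z∈X , z≢x = anotherVertex 2≤δ x∈X
      in exceptionalBound T ∅ (≤-trans (≤-reflexive (∣⊥∣≡0 n)) z≤n) (z≢x ∘ sym) x∈X z∈X
           (inside (p⊆p∪q ∅ ∘ X⊆T)) (inside (p⊆p∪q ∅ ∘ X⊆T))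
    ... | no X⊈T =
      let v , v∈X , v∉T = ⊈⇒witness X⊈T
      in afterFirst (firstForce S∩X⊆T (coloured v) v∈X v∉T)

Arc : ∀ {A : Set} → A → A → A → A → Set
Arc y x u w = u ≡ y × w ≡ x

Along : ∀ {A : Set} → A → A → A → A → Set
Along x y u w = Arc x y u w ⊎ Arc y x u w

module BridgeForces (G : Graph) (S : Subset (Graph.n G)) (zeroForcing : IsZeroForcingSet G S) where
  open Forcing G S

  -- Some endpoint of xy is coloured without any force along xy, because the
  -- first force along xy needs an endpoint coloured beforehand.
  cleanEndpoint : ∀ x y → ¬ ¬ (Col (Along x y) x ⊎ Col (Along x y) y)
  cleanEndpoint x y neither = neither (inj₁ (avoidForces along? bypass (zeroForcing x)))
    where
    along? : ∀ u w → Dec (Along x y u w)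
    along? u w = ((u ≟ x) ×-dec (w ≟ y)) ⊎-dec ((u ≟ y) ×-dec (w ≟ x))
    bypass : ∀ {u w} → Along x y u w → Col (Along x y) u → Col (Along x y) w
    bypass (inj₁ (refl , _)) cu = ⊥-elim (neither (inj₁ cu))
    bypass (inj₂ (refl , _)) cu = ⊥-elim (neither (inj₂ cu))

  avoidArc : ∀ {x y} → Col (Along x y) x → ∀ v → Col (Arc y x) v
  avoidArc {x} {y} cleanX v =
    avoidForces (λ u w → (u ≟ y) ×-dec (w ≟ x)) (λ { (_ , refl) _ → weaken inj₂ cleanX }) (zeroForcing v)

module TwoSides (G : Graph) (girth : GirthAtLeast G 5) (S : Subset (Graph.n G))
  {δ : ℕ} (minDegree : ∀ v → δ ≤ degree G v) (2≤δ : 2 ≤ δ) where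
  open Graph G using (n)
  open Forcing G S
  open Walks G

  -- Adding the two side estimates, whose sets share at most the vertex y.
  combine : ∀ {p q s} → δ + δ ≤ p + 4 → δ + δ ≤ q + 4 → p + q ≤ s + 1 → 4 * δ ≤ s + 9
  combine {p} {q} {s} δ+δ≤p+4 δ+δ≤q+4 p+q≤s+1 = begin
    4 * δ              ≡⟨ double δ ⟩
    (δ + δ) + (δ + δ)  ≤⟨ +-mono-≤ δ+δ≤p+4 δ+δ≤q+4 ⟩
    (p + 4) + (q + 4)  ≡⟨ regroup p q ⟩
    (p + q) + 8        ≤⟨ +-monoˡ-≤ 8 p+q≤s+1 ⟩
    (s + 1) + 8        ≡⟨ +-assoc s 1 8 ⟩
    s + 9              ∎
    where
    open ≤-Reasoning
    double : ∀ d → 4 * d ≡ (d + d) + (d + d)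
    double = solve-∀
    regroup : ∀ p q → (p + 4) + (q + 4) ≡ (p + q) + 8
    regroup = solve-∀

  -- The bound for a bridge xy when the force y → x is never used: apply
  -- sideBound to the component X of x with T = S ∩ X, and to the component Y of
  -- y with T = (S ∩ Y) ∪ {y}, since y may still be forced from x.
  twoSides : ∀ {x y} → ¬ WalkAvoiding G x y x y
    → (∀ i → Dec (WalkAvoiding G x y x i)) → (∀ i → Dec (WalkAvoiding G y x y i))
    → (∀ v → Col (Arc y x) v) → 4 * δ ≤ ∣ S ∣ + 9
  twoSides {x} {y} cut reachX? reachY? coloured = combine boundX boundY split
    where
    module CX = Component G cut
    module CY = Component G (cut-sym cut)

    X Y : Subset n
    X = ⟦ reachX? ⟧
    Y = ⟦ reachY? ⟧

    boundX : δ + δ ≤ ∣ S ∩ X ∣ + 4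
    boundX = Side.sideBound G girth S minDegree X y
      (λ u∈X ui i∉X → CX.exitOnly (∈⟦⟧⁻ u∈X) ui (i∉X ∘ ∈⟦⟧⁺))
      (S ∩ X) id
      (λ uw ¬yx w∈X _ → ∈⟦⟧⁺ (CX.entryOnly (∈⟦⟧⁻ w∈X) uw ¬yx))
      coloured 2≤δ (∈⟦⟧⁺ here)

    y∈T : ∀ {w} → w ≡ y → w ∈ (S ∩ Y) ∪ ⁅ y ⁆
    y∈T refl = x∈p∪q⁺ (inj₂ (x∈⁅x⁆ y))

    boundY : δ + δ ≤ ∣ (S ∩ Y) ∪ ⁅ y ⁆ ∣ + 4
    boundY = Side.sideBound G girth S minDegree Y x
      (λ u∈Y ui i∉Y → CY.exitOnly (∈⟦⟧⁻ u∈Y) ui (i∉Y ∘ ∈⟦⟧⁺))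
      ((S ∩ Y) ∪ ⁅ y ⁆) (p⊆p∪q ⁅ y ⁆)
      (λ uw _ w∈Y w∉T → ∈⟦⟧⁺ (CY.entryOnly (∈⟦⟧⁻ w∈Y) uw (w∉T ∘ y∈T ∘ proj₂)))
      coloured 2≤δ (∈⟦⟧⁺ here)

    split : ∣ S ∩ X ∣ + ∣ (S ∩ Y) ∪ ⁅ y ⁆ ∣ ≤ ∣ S ∣ + 1
    split = begin
      ∣ S ∩ X ∣ + ∣ (S ∩ Y) ∪ ⁅ y ⁆ ∣      ≤⟨ +-monoʳ-≤ ∣ S ∩ X ∣ (∣p∪q∣≤∣p∣+∣q∣ (S ∩ Y) ⁅ y ⁆) ⟩
      ∣ S ∩ X ∣ + (∣ S ∩ Y ∣ + ∣ ⁅ y ⁆ ∣)  ≡⟨ +-assoc (∣ S ∩ X ∣) (∣ S ∩ Y ∣) (∣ ⁅ y ⁆ ∣) ⟨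
      ∣ S ∩ X ∣ + ∣ S ∩ Y ∣ + ∣ ⁅ y ⁆ ∣
        ≤⟨ +-mono-≤ (disjoint-∣p∣+∣q∣≤∣r∣ separated (p∩q⊆p S X) (p∩q⊆p S Y)) (≤-reflexive (∣⁅x⁆∣≡1 y)) ⟩
      ∣ S ∣ + 1                            ∎
      where
      open ≤-Reasoning
      separated : ∀ {i} → i ∈ S ∩ X → i ∈ S ∩ Y → ⊥
      separated i∈S∩X i∈S∩Y =
        CX.separated (∈⟦⟧⁻ (proj₂ (x∈p∩q⁻ S X i∈S∩X))) (∈⟦⟧⁻ (proj₂ (x∈p∩q⁻ S Y i∈S∩Y)))

theorem6 : (G : Graph) (δ : ℕ) → IsMinDegree G δ → 3 ≤ δ → GirthAtLeast G 5
    → (a b : Vertex G) → IsCutEdge G a b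
    → (S : Subset (Graph.n G)) → IsZeroForcingSet G S
    → 4 * δ ∸ 9 ≤ ∣ S ∣
theorem6 G δ (minDegree , _) 3≤δ girth a b (_ , cut) S zeroForcing =
  decidable-stable (4 * δ ∸ 9 ≤? ∣ S ∣) (¬¬-map (m≤n+o⇒m∸n≤o (4 * δ) 9 ∘ subst (4 * δ ≤_) (+-comm ∣ S ∣ 9)) bound)
  where
  open Forcing G S
  open Walks G
  open BridgeForces G S zeroForcing
  open TwoSides G girth S minDegree (≤-trans (s≤s (s≤s z≤n)) 3≤δ)
  open RawMonad (¬¬-Monad {a = 0ℓ})

  -- The conclusion is decidable, so we may decide which endpoint of ab is clean
  -- and which vertices lie in which component of G − ab.
  bound : ¬ ¬ (4 * δ ≤ ∣ S ∣ + 9)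
  bound = do
    clean   ← cleanEndpoint a b
    reachA? ← ¬¬-decideAll (WalkAvoiding G a b a)
    reachB? ← ¬¬-decideAll (WalkAvoiding G b a b)
    pure (case clean of λ where
      (inj₁ cleanA) → twoSides cut reachA? reachB? (avoidArc cleanA)
      (inj₂ cleanB) → twoSides (cut-sym cut) reachB? reachA? (avoidArc (weaken Sum.swap cleanB)))
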